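{- Let $r\ge1$, $\mu=(\mu_1,\dots,\mu_r)$ a tuple of positive integers and $k\ge0$ an integer. If $\mathfrak t$ and $\mathfrak s$ are distinct elements of $\Omega^{\le}_A(\mu,k)$, then $\Omega(\mathfrak t)\cap\Omega(\mathfrak s)=\emptyset$.
   Context: $\Omega^{\le}(\mu)=\{(d_1,\dots,d_r)\in\mathbb Z_{\ge0}^r: d_j\le\mu_j\ \forall j\}$ and $\Omega^{\le}_A(\mu,k)=\{(d_1,\dots,d_r)\in\Omega^{\le}(\mu):\sum_id_i=k\}$. An element is maximal if it equals $\mu$. For non-maximal $\mathfrak s=(b_1,\dots,b_r)\in\Omega^{\le}(\mu)$, $i_\Box(\mathfrak s)=\max\{i:b_i<\mu_i\}$ and $\Omega(\mathfrak s)$ is the set of $(x_1,\dots,x_r)\in\Omega^{\le}(\mu)$ with $x_i=b_i$ for $i<i_\Box(\mathfrak s)$ and $x_i\le b_i$ for $i_\Box(\mathfrak s)\le i\le r$; for maximal $\mathfrak s$, $\Omega(\mathfrak s)=\Omega^{\le}(\mu)$. -}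

module Defs where

open import Data.Nat using (ℕ; suc; _≤_; _<_)
open import Data.Fin as Fin using (Fin)
open import Data.Vec using (Vec; lookup; sum)
open import Data.Product using (_×_; Σ-syntax)
open import Data.Sum using (_⊎_)
open import Relation.Binary.PropositionalEquality using (_≡_)
open import Relation.Nullary using (¬_)

InΩ≤ : ∀ {r} → Vec ℕ r → Vec ℕ r → Set
InΩ≤ μ d = ∀ j → lookup d j ≤ lookup μ j

InΩA : ∀ {r} → Vec ℕ r → ℕ → Vec ℕ r → Set
InΩA μ k d = InΩ≤ μ d × sum d ≡ k

IsMaximal : ∀ {r} → Vec ℕ r → Vec ℕ r → Set
IsMaximal μ s = s ≡ μ

IsIBox : ∀ {r} → Vec ℕ r → Vec ℕ r → Fin r → Set
IsIBox μ s i = (lookup s i < lookup μ i)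
             × (∀ j → i Fin.< j → ¬ (lookup s j < lookup μ j))

InΩ : ∀ {r} → Vec ℕ r → Vec ℕ r → Vec ℕ r → Set
InΩ μ s x = InΩ≤ μ x ×
  (IsMaximal μ s
   ⊎ Σ[ i ∈ Fin _ ] (IsIBox μ s i
        × (∀ l → l Fin.< i → lookup x l ≡ lookup s l)
        × (∀ l → i Fin.≤ l → lookup x l ≤ lookup s l)))

-- If x lies in Ω(t) ∩ Ω(s), then t and s are comparable coordinatewise: below the
-- smaller of the two i_□ indices both agree with x, at that index the one with the
-- smaller i_□ bounds x and hence the other, and beyond it that one already equals μ.
-- Coordinatewise comparable vectors with the same coordinate sum are equal.
module Submission where

open import Defs
open import Data.Nat using (ℕ; suc; _≤_; _+_; z≤n)
open import Data.Nat.Properties using (≤-trans; ≤-total; ≮⇒≥; ≤-reflexive; ≤-antisym; +-mono-≤; +-monoʳ-≤; +-cancelˡ-≡; +-cancelʳ-≤)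
open import Data.Fin as Fin using (Fin)
open import Data.Fin.Properties using (<-cmp; <-trans; ≤-refl)
open import Data.Vec using (Vec; lookup; sum; []; _∷_)
open import Data.Empty using (⊥)
open import Data.Sum using (_⊎_; inj₁; inj₂)
open import Data.Product using (_,_)
open import Relation.Binary using (tri<; tri≈; tri>)
open import Relation.Binary.PropositionalEquality using (_≡_; refl; sym; trans; cong; cong₂; subst)
open import Relation.Nullary using (¬_)

infix 4 _≼_

_≼_ : ∀ {r} → Vec ℕ r → Vec ℕ r → Set
u ≼ v = ∀ j → lookup u j ≤ lookup v j

≼-tail : ∀ {r a b} (u v : Vec ℕ r) → a ∷ u ≼ b ∷ v → u ≼ v
≼-tail _ _ u≼v j = u≼v (Fin.suc j)

sum-mono-≼ : ∀ {r} (u v : Vec ℕ r) → u ≼ v → sum u ≤ sum v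
sum-mono-≼ []      []      _   = z≤n
sum-mono-≼ (_ ∷ u) (_ ∷ v) u≼v = +-mono-≤ (u≼v Fin.zero) (sum-mono-≼ u v (≼-tail u v u≼v))

≼∧sum≡⇒≡ : ∀ {r} (u v : Vec ℕ r) → u ≼ v → sum u ≡ sum v → u ≡ v
≼∧sum≡⇒≡ []      []      _   _ = refl
≼∧sum≡⇒≡ (a ∷ u) (b ∷ v) u≼v Σu≡Σv = cong₂ _∷_ a≡b (≼∧sum≡⇒≡ u v (≼-tail u v u≼v) Σu≡Σv′)
  where
    b≤a : b ≤ a
    b≤a = +-cancelʳ-≤ (sum v) b a
            (≤-trans (≤-reflexive (sym Σu≡Σv)) (+-monoʳ-≤ a (sum-mono-≼ u v (≼-tail u v u≼v))))
    a≡b : a ≡ b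
    a≡b = ≤-antisym (u≼v Fin.zero) b≤a
    Σu≡Σv′ : sum u ≡ sum v
    Σu≡Σv′ = +-cancelˡ-≡ a (sum u) (sum v) (trans Σu≡Σv (cong (_+ sum v) (sym a≡b)))

-- Beyond i_□(t) every coordinate of t is μ's, so only the prefix up to i_□(t) matters.
≼-from-iBox : ∀ {r} (μ t s : Vec ℕ r) {i : Fin r} → IsIBox μ t i → s ≼ μ
  → (∀ l → l Fin.< i → lookup s l ≡ lookup t l) → lookup s i ≤ lookup t i → s ≼ t
≼-from-iBox _ _ _ {i} (_ , t≥μ-beyond) s≼μ s≡t-below sᵢ≤tᵢ l with <-cmp l i
... | tri< l<i _ _ = ≤-reflexive (s≡t-below l l<i)
... | tri≈ _ refl _ = sᵢ≤tᵢ
... | tri> _ _ i<l = ≤-trans (s≼μ l) (≮⇒≥ (t≥μ-beyond l i<l))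

Ω-comparable : ∀ {r} (μ t s x : Vec ℕ r) → t ≼ μ → s ≼ μ
  → InΩ μ t x → InΩ μ s x → s ≼ t ⊎ t ≼ s
Ω-comparable _ _ _ _ _   s≼μ (_ , inj₁ refl) _ = inj₁ s≼μ
Ω-comparable _ _ _ _ t≼μ _   _ (_ , inj₁ refl) = inj₂ t≼μ
Ω-comparable μ t s _ t≼μ s≼μ
  (_ , inj₂ (i , boxₜ , x≡t-below , x≤t-from)) (_ , inj₂ (i′ , boxₛ , x≡s-below , x≤s-from))
  with <-cmp i i′
... | tri< i<i′ _ _ = inj₁ (≼-from-iBox μ t s boxₜ s≼μ
        (λ l l<i → trans (sym (x≡s-below l (<-trans l<i i<i′))) (x≡t-below l l<i))
        (subst (_≤ lookup t i) (x≡s-below i i<i′) (x≤t-from i ≤-refl)))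
... | tri> _ _ i′<i = inj₂ (≼-from-iBox μ s t boxₛ t≼μ
        (λ l l<i′ → trans (sym (x≡t-below l (<-trans l<i′ i′<i))) (x≡s-below l l<i′))
        (subst (_≤ lookup s i′) (x≡t-below i′ i′<i) (x≤s-from i′ ≤-refl)))
... | tri≈ _ refl _ with ≤-total (lookup s i) (lookup t i)
...   | inj₁ sᵢ≤tᵢ = inj₁ (≼-from-iBox μ t s boxₜ s≼μ
          (λ l l<i → trans (sym (x≡s-below l l<i)) (x≡t-below l l<i)) sᵢ≤tᵢ)
...   | inj₂ tᵢ≤sᵢ = inj₂ (≼-from-iBox μ s t boxₛ t≼μ
          (λ l l<i → trans (sym (x≡t-below l l<i)) (x≡s-below l l<i)) tᵢ≤sᵢ)

lemma4 : (n : ℕ) (μ : Vec ℕ (suc n)) → (∀ j → 1 ≤ lookup μ j) → (k : ℕ)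
    → (t s : Vec ℕ (suc n)) → InΩA μ k t → InΩA μ k s → ¬ (t ≡ s)
    → (x : Vec ℕ (suc n)) → InΩ μ t x → InΩ μ s x → ⊥
lemma4 _ μ _ _ t s (t≼μ , Σt≡k) (s≼μ , Σs≡k) t≢s x x∈Ωt x∈Ωs
  with Ω-comparable μ t s x t≼μ s≼μ x∈Ωt x∈Ωs
... | inj₁ s≼t = t≢s (sym (≼∧sum≡⇒≡ s t s≼t (trans Σs≡k (sym Σt≡k))))
... | inj₂ t≼s = t≢s (≼∧sum≡⇒≡ t s t≼s (trans Σt≡k (sym Σs≡k)))
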